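{- For all integers $n, k \geq 1$ with $n \geq k$, $$\sum_{k \le i \le n} \frac{S(n-1,i-1)\, s(i,k)}{i} = \frac{1}{n}\binom{n}{k} B_{n-k}.$$
   Context: $X^{\underline{n}} := X(X-1)\cdots(X-n+1)$. The (signed) Stirling numbers of the first kind $s(n,k)$ are defined by $X^{\underline{n}} = \sum_{k=0}^{n} s(n,k) X^k$, and the Stirling numbers of the second kind $S(n,k)$ by $X^n = \sum_{k=0}^{n} S(n,k) X^{\underline{k}}$ ($n\ge0$), with $s(n,k)=S(n,k)=0$ for $n<k$. The Bernoulli numbers $B_n$ are defined by $\frac{t}{e^t-1} = \sum_{n\ge 0} B_n \frac{t^n}{n!}$. -}

module Defs where

open import Data.Nat as ℕ using (ℕ; zero; suc)
open import Data.Nat.Combinatorics using (_C_)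
open import Data.Integer as ℤ using (ℤ; +_)
open import Data.Rational as ℚ using (ℚ; _/_)
open import Data.List using (List; []; _∷_; map; upTo; foldr)

-- Signed Stirling numbers of the first kind s(n,k):
-- X(X-1)...(X-n+1) = Σ_k s(n,k) X^k, equivalently
-- s(0,0)=1, s(0,k+1)=0, s(n+1,0)=0, s(n+1,k+1) = s(n,k) - n·s(n,k+1).
stirling1 : ℕ → ℕ → ℤ
stirling1 zero    zero    = + 1
stirling1 zero    (suc k) = + 0
stirling1 (suc n) zero    = + 0
stirling1 (suc n) (suc k) = stirling1 n k ℤ.- (+ n) ℤ.* stirling1 n (suc k)

stirling2 : ℕ → ℕ → ℕ
stirling2 zero    zero    = 1
stirling2 zero    (suc k) = 0
stirling2 (suc n) zero    = 0
stirling2 (suc n) (suc k) = stirling2 n k ℕ.+ suc k ℕ.* stirling2 n (suc k)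

sumℚ : List ℚ → ℚ
sumℚ = foldr ℚ._+_ ℚ.0ℚ

-- Bernoulli numbers with t/(e^t-1) = Σ B_n t^n/n! (so B_1 = -1/2).
-- Comparing coefficients in (e^t-1)/t · t/(e^t-1) = 1 gives
-- B_0 = 1,  B_m = -1/(m+1) · Σ_{j<m} C(m+1,j) B_j.
-- We compute the list [B_0, ..., B_{n}] (reversed) by well-founded structure
-- on n: bernoulliList n = B_n ∷ B_{n-1} ∷ ... ∷ B_0 ∷ [].
private
  index : List ℚ → ℕ → ℚ
  index []       _       = ℚ.0ℚ
  index (x ∷ xs) zero    = x
  index (x ∷ xs) (suc i) = index xs i

  lenL : List ℚ → ℕ
  lenL [] = 0
  lenL (_ ∷ xs) = suc (lenL xs)

  getB : List ℚ → ℕ → ℚ   -- prev = B_{m-1} ∷ ... ∷ B_0, get B_j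
  getB prev j = index prev (lenL prev ℕ.∸ suc j)

bernoulliList : ℕ → List ℚ
bernoulliList zero    = ℚ.1ℚ ∷ []
bernoulliList (suc m) =
  let prev = bernoulliList m
      bm   = ℚ.- ((+ 1 / (suc (suc m))) ℚ.*
               sumℚ (map (λ j → ((+ (suc (suc m) C j)) / 1) ℚ.* getB prev j)
                         (upTo (suc m))))
  in bm ∷ prev

bernoulli : ℕ → ℚ
bernoulli n with bernoulliList n
... | []    = ℚ.0ℚ
... | b ∷ _ = b

-- the left-hand side summand, i ranges over k ≤ i ≤ n
-- (i ≥ k ≥ 1 so division by i is fine; for i = 0 we return 0, never used)
term : ℕ → ℕ → ℕ → ℚ
term n k zero    = ℚ.0ℚ
term n k (suc j) =
  ((+ stirling2 (n ℕ.∸ 1) j) ℤ.* stirling1 (suc j) k) / suc j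

rangeFromTo : ℕ → ℕ → List ℕ
rangeFromTo k n = map (k ℕ.+_) (upTo (suc n ℕ.∸ k))

-- 1/n as a rational (only used for n ≥ 1; 1/0 := 0 by convention)
recipℕ : ℕ → ℚ
recipℕ zero    = ℚ.0ℚ
recipℕ (suc m) = + 1 / suc m

{-# OPTIONS --safe #-}
-- Write n = p + 1 and read sequences f : ℕ → ℚ as coefficient lists of polynomials. The binomial
-- transform (T f) j = Σ_k C(k,j) f k is the Taylor shift f(X) ↦ f(X + 1). Viewed as sequences in k,
-- both sides of the identity satisfy T f = f + e_p in all coefficients j ≤ p. For the Stirling side
-- this is (X + 1)^(i+1 falling) = (X + 1) · X^(i falling) together with the inverse-matrix relation
-- between the two kinds of Stirling numbers; for the Bernoulli side it is the revision
-- C(n,k) C(k,j) = C(n,j) C(n-j,k-j) together with Σ_m C(N,m) B_(N-m) = B_N + [N = 1], which is the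
-- defining recurrence of the B_m. The difference of the two sides has degree at most n and satisfies
-- f(X + 1) = f(X) in degrees below n, so it is constant, and the two sides agree for k ≥ 1.
module Submission where

open import Defs
open import Data.Nat as ℕ using (ℕ; zero; suc; _<_; _≤_; z≤n; s≤s; _∸_; _!)
import Data.Nat.Properties as ℕP
open import Data.Nat.Properties using (_!≢0)
open import Data.Nat.Combinatorics
  using (_C_; nCk+nC[k+1]≡[n+1]C[k+1]; nCk≡nC[n∸k]; nC1≡n; nCn≡1; k>n⇒nCk≡0; nCk≡n!/k![n-k]!; k![n∸k]!∣n!)
open import Data.Nat.DivMod using (m/n*n≡m)
open import Data.Integer as ℤ using (ℤ; +_; +[1+_])
import Data.Integer.Properties as ℤP
open import Data.Rational as ℚ using (ℚ; _+_; _*_; _-_; -_; 0ℚ; 1ℚ; mkℚ; _/_)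
import Data.Rational.Properties as ℚP
open import Algebra.Properties.Group ℚP.+-0-group using (inverseʳ-unique; identityʳ-unique; x∙y⁻¹≈ε⇒x≈y)
open import Data.Rational.Solver using (module +-*-Solver)
import Data.Nat.Solver as ℕ-Solver
import Data.Nat.Coprimality as Coprime
open import Data.List using (List; map; applyUpTo; upTo)
open import Data.List.Properties using (map-∘)
open import Data.Product using (_,_)
open import Function using (_∘_)
open import Relation.Binary.PropositionalEquality
open import Relation.Nullary using (yes; no; contradiction)

[1+n]Cn≡1+n : ∀ n → suc n C n ≡ suc n
[1+n]Cn≡1+n n = begin
  suc n C n              ≡⟨ nCk≡nC[n∸k] (ℕP.n≤1+n n) ⟩
  suc n C (suc n ∸ n)    ≡⟨ cong (suc n C_) (ℕP.m+n∸n≡m 1 n) ⟩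
  suc n C 1              ≡⟨ nC1≡n (suc n) ⟩
  suc n                  ∎
  where open ≡-Reasoning

C*factorials : ∀ k m → ((k ℕ.+ m) C k) ℕ.* (k ! ℕ.* m !) ≡ (k ℕ.+ m) !
C*factorials k m = begin
  (n C k) ℕ.* (k ! ℕ.* m !)                                ≡⟨ cong (λ i → (n C k) ℕ.* (k ! ℕ.* i !)) (sym (ℕP.m+n∸m≡n k m)) ⟩
  (n C k) ℕ.* (k ! ℕ.* (n ∸ k) !)                          ≡⟨ cong (ℕ._* (k ! ℕ.* (n ∸ k) !)) (nCk≡n!/k![n-k]! k≤n) ⟩
  (n ! ℕ./ (k ! ℕ.* (n ∸ k) !)) ℕ.* (k ! ℕ.* (n ∸ k) !)    ≡⟨ m/n*n≡m (k![n∸k]!∣n! k≤n) ⟩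
  n !                                                      ∎
  where
  open ≡-Reasoning
  n = k ℕ.+ m
  k≤n = ℕP.m≤m+n k m
  instance _ = ℕP.m*n≢0 (k !) ((n ∸ k) !) {{k !≢0}} {{(n ∸ k) !≢0}}

C-trinomial : ∀ j m r → ((j ℕ.+ (m ℕ.+ r)) C (j ℕ.+ m)) ℕ.* ((j ℕ.+ m) C j) ≡ ((j ℕ.+ (m ℕ.+ r)) C j) ℕ.* ((m ℕ.+ r) C m)
C-trinomial j m r = ℕP.*-cancelʳ-≡ _ _ (j ! ℕ.* m ! ℕ.* r !) {{factorials≢0}} (trans lhs (sym rhs))
  where
  open ≡-Reasoning
  open ℕ-Solver.+-*-Solver
  n = j ℕ.+ (m ℕ.+ r)
  factorials≢0 = ℕP.m*n≢0 (j ! ℕ.* m !) (r !) {{ℕP.m*n≢0 (j !) (m !) {{j !≢0}} {{m !≢0}}}} {{r !≢0}}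
  lhs : (n C (j ℕ.+ m)) ℕ.* ((j ℕ.+ m) C j) ℕ.* (j ! ℕ.* m ! ℕ.* r !) ≡ n !
  lhs = begin
    (n C (j ℕ.+ m)) ℕ.* ((j ℕ.+ m) C j) ℕ.* (j ! ℕ.* m ! ℕ.* r !)
      ≡⟨ solve 5 (λ a b x y z → a :* b :* (x :* y :* z) := a :* ((b :* (x :* y)) :* z)) refl
           (n C (j ℕ.+ m)) ((j ℕ.+ m) C j) (j !) (m !) (r !) ⟩
    (n C (j ℕ.+ m)) ℕ.* (((j ℕ.+ m) C j) ℕ.* (j ! ℕ.* m !) ℕ.* r !)
      ≡⟨ cong (λ x → (n C (j ℕ.+ m)) ℕ.* (x ℕ.* r !)) (C*factorials j m) ⟩
    (n C (j ℕ.+ m)) ℕ.* ((j ℕ.+ m) ! ℕ.* r !)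
      ≡⟨ cong (λ x → (x C (j ℕ.+ m)) ℕ.* ((j ℕ.+ m) ! ℕ.* r !)) (sym (ℕP.+-assoc j m r)) ⟩
    ((j ℕ.+ m ℕ.+ r) C (j ℕ.+ m)) ℕ.* ((j ℕ.+ m) ! ℕ.* r !)
      ≡⟨ C*factorials (j ℕ.+ m) r ⟩
    (j ℕ.+ m ℕ.+ r) !
      ≡⟨ cong _! (ℕP.+-assoc j m r) ⟩
    n !
      ∎
  rhs : (n C j) ℕ.* ((m ℕ.+ r) C m) ℕ.* (j ! ℕ.* m ! ℕ.* r !) ≡ n !
  rhs = begin
    (n C j) ℕ.* ((m ℕ.+ r) C m) ℕ.* (j ! ℕ.* m ! ℕ.* r !)
      ≡⟨ solve 5 (λ a b x y z → a :* b :* (x :* y :* z) := a :* (x :* (b :* (y :* z)))) refl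
           (n C j) ((m ℕ.+ r) C m) (j !) (m !) (r !) ⟩
    (n C j) ℕ.* (j ! ℕ.* (((m ℕ.+ r) C m) ℕ.* (m ! ℕ.* r !)))
      ≡⟨ cong (λ x → (n C j) ℕ.* (j ! ℕ.* x)) (C*factorials m r) ⟩
    (n C j) ℕ.* (j ! ℕ.* (m ℕ.+ r) !)
      ≡⟨ C*factorials j (m ℕ.+ r) ⟩
    n !
      ∎

<-downward-induction : ∀ {ℓ} (P : ℕ → Set ℓ) n → (∀ k → n ≤ k → P k) →
                       (∀ k → k < n → (∀ m → k < m → P m) → P k) → ∀ k → P k
<-downward-induction P n above step k = go n k (ℕP.m≤n+m n k)
  where
  go : ∀ d k → n ≤ k ℕ.+ d → P k
  go d k n≤k+d with n ℕ.≤? k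
  ... | yes n≤k = above k n≤k
  go zero    k n≤k+0   | no n≰k = contradiction (subst (n ≤_) (ℕP.+-identityʳ k) n≤k+0) n≰k
  go (suc d) k n≤k+1+d | no n≰k = step k (ℕP.≰⇒> n≰k) (λ m k<m → go d m (ℕP.≤-trans n≤k+1+d
    (ℕP.≤-trans (ℕP.≤-reflexive (ℕP.+-suc k d)) (ℕP.+-monoˡ-≤ d k<m))))

open +-*-Solver

infix 6.5 ∑
∑ : ℕ → (ℕ → ℚ) → ℚ
∑ zero    f = 0ℚ
∑ (suc n) f = f 0 + ∑ n (f ∘ suc)

syntax ∑ n (λ i → x) = ∑[ i < n ] x

∑-cong : ∀ n {f g : ℕ → ℚ} → (∀ i → i < n → f i ≡ g i) → ∑ n f ≡ ∑ n g
∑-cong zero    eq = refl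
∑-cong (suc n) eq = cong₂ _+_ (eq 0 (s≤s z≤n)) (∑-cong n (λ i i<n → eq (suc i) (s≤s i<n)))

∑-≡0 : ∀ n {f : ℕ → ℚ} → (∀ i → i < n → f i ≡ 0ℚ) → ∑ n f ≡ 0ℚ
∑-≡0 n {f} f≡0 = trans (∑-cong n f≡0) (∑-0 n)
  where
  ∑-0 : ∀ n → ∑[ i < n ] 0ℚ ≡ 0ℚ
  ∑-0 zero    = refl
  ∑-0 (suc n) = trans (ℚP.+-identityˡ _) (∑-0 n)

∑-split : ∀ m n (f : ℕ → ℚ) → ∑ (m ℕ.+ n) f ≡ ∑ m f + ∑[ i < n ] f (m ℕ.+ i)
∑-split zero    n f = sym (ℚP.+-identityˡ _)
∑-split (suc m) n f = trans (cong (_+_ (f 0)) (∑-split m n (f ∘ suc))) (sym (ℚP.+-assoc (f 0) _ _))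

∑-init-last : ∀ n (f : ℕ → ℚ) → ∑ (suc n) f ≡ ∑ n f + f n
∑-init-last n f = begin
  ∑ (suc n) f                  ≡⟨ cong (λ m → ∑ m f) (ℕP.+-comm 1 n) ⟩
  ∑ (n ℕ.+ 1) f                ≡⟨ ∑-split n 1 f ⟩
  ∑ n f + (f (n ℕ.+ 0) + 0ℚ)   ≡⟨ cong (_+_ (∑ n f)) (trans (ℚP.+-identityʳ _) (cong f (ℕP.+-identityʳ n))) ⟩
  ∑ n f + f n                  ∎
  where open ≡-Reasoning

∑-truncate : ∀ {m n} (f : ℕ → ℚ) → m ≤ n → (∀ i → m ≤ i → f i ≡ 0ℚ) → ∑ n f ≡ ∑ m f
∑-truncate {m} f m≤n f≡0 with ℕP.m≤n⇒∃[o]m+o≡n m≤n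
... | o , refl = begin
  ∑ (m ℕ.+ o) f                        ≡⟨ ∑-split m o f ⟩
  ∑ m f + ∑[ i < o ] f (m ℕ.+ i)       ≡⟨ cong (_+_ (∑ m f)) (∑-≡0 o (λ i _ → f≡0 (m ℕ.+ i) (ℕP.m≤m+n m i))) ⟩
  ∑ m f + 0ℚ                           ≡⟨ ℚP.+-identityʳ _ ⟩
  ∑ m f                                ∎
  where open ≡-Reasoning

∑-distrib-+ : ∀ n (f g : ℕ → ℚ) → ∑[ i < n ] (f i + g i) ≡ ∑ n f + ∑ n g
∑-distrib-+ zero    f g = refl
∑-distrib-+ (suc n) f g = trans (cong (_+_ (f 0 + g 0)) (∑-distrib-+ n (f ∘ suc) (g ∘ suc)))
  (solve 4 (λ a b c d → (a :+ b) :+ (c :+ d) := (a :+ c) :+ (b :+ d)) refl (f 0) (g 0) _ _)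

∑-*ˡ : ∀ n (c : ℚ) (f : ℕ → ℚ) → ∑[ i < n ] (c * f i) ≡ c * ∑ n f
∑-*ˡ zero    c f = sym (ℚP.*-zeroʳ c)
∑-*ˡ (suc n) c f = trans (cong (_+_ (c * f 0)) (∑-*ˡ n c (f ∘ suc))) (sym (ℚP.*-distribˡ-+ c _ _))

∑-neg : ∀ n (f : ℕ → ℚ) → ∑[ i < n ] (- f i) ≡ - ∑ n f
∑-neg zero    f = refl
∑-neg (suc n) f = trans (cong (_+_ (- f 0)) (∑-neg n (f ∘ suc))) (sym (ℚP.neg-distrib-+ (f 0) _))

∑-distrib-- : ∀ n (f g : ℕ → ℚ) → ∑[ i < n ] (f i - g i) ≡ ∑ n f - ∑ n g
∑-distrib-- n f g = trans (∑-distrib-+ n f (-_ ∘ g)) (cong (_+_ (∑ n f)) (∑-neg n g))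

∑-comm : ∀ m n (f : ℕ → ℕ → ℚ) → ∑[ i < m ] ∑[ j < n ] f i j ≡ ∑[ j < n ] ∑[ i < m ] f i j
∑-comm zero    n f = sym (∑-≡0 n (λ _ _ → refl))
∑-comm (suc m) n f = trans (cong (_+_ (∑[ j < n ] f 0 j)) (∑-comm m n (f ∘ suc)))
  (sym (∑-distrib-+ n (f 0) (λ j → ∑[ i < m ] f (suc i) j)))

∑-telescope : ∀ n (g : ℕ → ℚ) → ∑[ i < n ] (g (suc i) - g i) ≡ g n - g 0
∑-telescope zero    g = sym (ℚP.+-inverseʳ (g 0))
∑-telescope (suc n) g = trans (cong (_+_ (g 1 - g 0)) (∑-telescope n (g ∘ suc)))
  (solve 3 (λ a b c → (a :- b) :+ (c :- a) := c :- b) refl (g 1) (g 0) (g (suc n)))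

∑-reverse : ∀ n (f : ℕ → ℚ) → ∑ n f ≡ ∑[ i < n ] f (n ∸ suc i)
∑-reverse zero    f = refl
∑-reverse (suc n) f = begin
  f 0 + ∑[ i < n ] f (suc i)
    ≡⟨ cong (_+_ (f 0)) (∑-reverse n (f ∘ suc)) ⟩
  f 0 + ∑[ i < n ] f (suc (n ∸ suc i))
    ≡⟨ ℚP.+-comm (f 0) _ ⟩
  ∑[ i < n ] f (suc (n ∸ suc i)) + f 0
    ≡⟨ cong₂ _+_ (∑-cong n (λ i i<n → cong f (sym (ℕP.+-∸-assoc 1 i<n)))) (cong f (sym (ℕP.n∸n≡0 n))) ⟩
  ∑[ i < n ] f (suc n ∸ suc i) + f (suc n ∸ suc n)
    ≡⟨ sym (∑-init-last n (λ i → f (suc n ∸ suc i))) ⟩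
  ∑[ i < suc n ] f (suc n ∸ suc i)
    ∎
  where open ≡-Reasoning

sumℚ-map-applyUpTo : ∀ (f : ℕ → ℚ) g n → sumℚ (map f (applyUpTo g n)) ≡ ∑[ i < n ] f (g i)
sumℚ-map-applyUpTo f g zero    = refl
sumℚ-map-applyUpTo f g (suc n) = cong (_+_ (f (g 0))) (sumℚ-map-applyUpTo f (g ∘ suc) n)

fromℤ : ℤ → ℚ
fromℤ z = z / 1

fromℕ : ℕ → ℚ
fromℕ n = fromℤ (+ n)

fromℤ≡mkℚ : ∀ z → fromℤ z ≡ mkℚ z 0 (Coprime.sym (Coprime.1-coprimeTo ℤ.∣ z ∣))
fromℤ≡mkℚ z = ℚP.↥p/↧p≡p _

fromℤ-+ : ∀ a b → fromℤ (a ℤ.+ b) ≡ fromℤ a + fromℤ b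
fromℤ-+ a b = sym (trans (cong₂ _+_ (fromℤ≡mkℚ a) (fromℤ≡mkℚ b))
  (cong (_/ 1) (cong₂ ℤ._+_ (ℤP.*-identityʳ a) (ℤP.*-identityʳ b))))

fromℤ-* : ∀ a b → fromℤ (a ℤ.* b) ≡ fromℤ a * fromℤ b
fromℤ-* a b = sym (cong₂ _*_ (fromℤ≡mkℚ a) (fromℤ≡mkℚ b))

fromℤ-neg : ∀ a → fromℤ (ℤ.- a) ≡ - fromℤ a
fromℤ-neg a = inverseʳ-unique (fromℤ a) (fromℤ (ℤ.- a))
  (trans (sym (fromℤ-+ a (ℤ.- a))) (cong fromℤ (ℤP.+-inverseʳ a)))

fromℤ-- : ∀ a b → fromℤ (a ℤ.- b) ≡ fromℤ a - fromℤ b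
fromℤ-- a b = trans (fromℤ-+ a (ℤ.- b)) (cong (_+_ (fromℤ a)) (fromℤ-neg b))

fromℕ-+ : ∀ m n → fromℕ (m ℕ.+ n) ≡ fromℕ m + fromℕ n
fromℕ-+ m n = fromℤ-+ (+ m) (+ n)

fromℕ-* : ∀ m n → fromℕ (m ℕ.* n) ≡ fromℕ m * fromℕ n
fromℕ-* m n = trans (cong fromℤ (ℤP.pos-* m n)) (fromℤ-* (+ m) (+ n))

fromℕ-suc : ∀ n → fromℕ (suc n) ≡ 1ℚ + fromℕ n
fromℕ-suc n = fromℕ-+ 1 n

fromℕ-*-recipℕ : ∀ n → fromℕ (suc n) * recipℕ (suc n) ≡ 1ℚ
fromℕ-*-recipℕ n = trans (cong₂ _*_ (fromℤ≡mkℚ (+ suc n)) (ℚP.↥p/↧p≡p (mkℚ (+ 1) n (Coprime.1-coprimeTo (suc n)))))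
  (ℚP.*-inverseʳ (mkℚ +[1+ n ] 0 (Coprime.sym (Coprime.1-coprimeTo (suc n)))))

/-suc≡*recipℕ : ∀ z n → z / suc n ≡ fromℤ z * recipℕ (suc n)
/-suc≡*recipℕ z n = sym (trans (cong₂ _*_ (fromℤ≡mkℚ z) (ℚP.↥p/↧p≡p (mkℚ (+ 1) n (Coprime.1-coprimeTo (suc n)))))
  (ℚP./-cong (ℤP.*-identityʳ z) (ℕP.*-identityˡ (suc n))))

[1+n]*x≡0⇒x≡0 : ∀ n {x} → fromℕ (suc n) * x ≡ 0ℚ → x ≡ 0ℚ
[1+n]*x≡0⇒x≡0 n {x} eq = begin
  x                                     ≡⟨ sym (ℚP.*-identityˡ x) ⟩
  1ℚ * x                                ≡⟨ cong (_* x) (sym (trans (ℚP.*-comm (recipℕ (suc n)) (fromℕ (suc n))) (fromℕ-*-recipℕ n))) ⟩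
  recipℕ (suc n) * fromℕ (suc n) * x    ≡⟨ ℚP.*-assoc (recipℕ (suc n)) (fromℕ (suc n)) x ⟩
  recipℕ (suc n) * (fromℕ (suc n) * x)  ≡⟨ cong (recipℕ (suc n) *_) eq ⟩
  recipℕ (suc n) * 0ℚ                   ≡⟨ ℚP.*-zeroʳ (recipℕ (suc n)) ⟩
  0ℚ                                    ∎
  where open ≡-Reasoning

x*0*y≡0 : ∀ x y → x * 0ℚ * y ≡ 0ℚ
x*0*y≡0 = solve 2 (λ x y → x :* con 0ℚ :* y := con 0ℚ) refl

s : ℕ → ℕ → ℚ
s n k = fromℤ (stirling1 n k)

S : ℕ → ℕ → ℚ
S n k = fromℕ (stirling2 n k)

stirling1-vanish : ∀ {n k} → n < k → stirling1 n k ≡ + 0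
stirling1-vanish {zero}  {suc k}       _         = refl
stirling1-vanish {suc n} {suc (suc k)} (s≤s n<k) = begin
  stirling1 n (suc k) ℤ.- + n ℤ.* stirling1 n (suc (suc k))
    ≡⟨ cong₂ (λ a b → a ℤ.- + n ℤ.* b) (stirling1-vanish n<k) (stirling1-vanish (ℕP.m<n⇒m<1+n n<k)) ⟩
  + 0 ℤ.- + n ℤ.* + 0
    ≡⟨ cong (ℤ._-_ (+ 0)) (ℤP.*-zeroʳ (+ n)) ⟩
  + 0
    ∎
  where open ≡-Reasoning

stirling2-vanish : ∀ {n k} → n < k → stirling2 n k ≡ 0
stirling2-vanish {zero}  {suc k}       _         = refl
stirling2-vanish {suc n} {suc (suc k)} (s≤s n<k) = begin
  stirling2 n (suc k) ℕ.+ suc (suc k) ℕ.* stirling2 n (suc (suc k))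
    ≡⟨ cong₂ (λ a b → a ℕ.+ suc (suc k) ℕ.* b) (stirling2-vanish n<k) (stirling2-vanish (ℕP.m<n⇒m<1+n n<k)) ⟩
  suc (suc k) ℕ.* 0
    ≡⟨ ℕP.*-zeroʳ (suc (suc k)) ⟩
  0
    ∎
  where open ≡-Reasoning

s-vanish : ∀ {n k} → n < k → s n k ≡ 0ℚ
s-vanish n<k = cong fromℤ (stirling1-vanish n<k)

S-vanish : ∀ {n k} → n < k → S n k ≡ 0ℚ
S-vanish n<k = cong fromℕ (stirling2-vanish n<k)

s-suc-suc : ∀ n k → s (suc n) (suc k) ≡ s n k - fromℕ n * s n (suc k)
s-suc-suc n k = trans (fromℤ-- (stirling1 n k) (+ n ℤ.* stirling1 n (suc k)))
  (cong (_-_ (s n k)) (fromℤ-* (+ n) (stirling1 n (suc k))))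

S-suc-suc : ∀ n k → S (suc n) (suc k) ≡ S n k + fromℕ (suc k) * S n (suc k)
S-suc-suc n k = trans (fromℕ-+ (stirling2 n k) _) (cong (_+_ (S n k)) (fromℕ-* (suc k) (stirling2 n (suc k))))

-- Coefficients of X · f, for f a coefficient sequence.
shift : (ℕ → ℚ) → ℕ → ℚ
shift f zero    = 0ℚ
shift f (suc k) = f k

n*s[n,0]≡0 : ∀ n → fromℕ n * s n 0 ≡ 0ℚ
n*s[n,0]≡0 zero    = ℚP.*-zeroˡ (s 0 0)
n*s[n,0]≡0 (suc n) = ℚP.*-zeroʳ (fromℕ (suc n))

s-suc : ∀ n k → s (suc n) k ≡ shift (s n) k - fromℕ n * s n k
s-suc n zero    = sym (cong (_-_ 0ℚ) (n*s[n,0]≡0 n))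
s-suc n (suc k) = s-suc-suc n k

shift-s : ∀ n k → shift (s n) k ≡ s (suc n) k + fromℕ n * s n k
shift-s n k = begin
  shift (s n) k                                         ≡⟨ solve 2 (λ a b → a := (a :- b) :+ b) refl (shift (s n) k) (fromℕ n * s n k) ⟩
  (shift (s n) k - fromℕ n * s n k) + fromℕ n * s n k   ≡⟨ cong (_+ fromℕ n * s n k) (sym (s-suc n k)) ⟩
  s (suc n) k + fromℕ n * s n k                         ∎
  where open ≡-Reasoning

δ : ℕ → ℕ → ℚ
δ zero    zero    = 1ℚ
δ zero    (suc _) = 0ℚ
δ (suc _) zero    = 0ℚ
δ (suc m) (suc n) = δ m n

δ-+ˡ : ∀ m n → δ (m ℕ.+ n) m ≡ δ n 0
δ-+ˡ zero    n = refl
δ-+ˡ (suc m) n = δ-+ˡ m n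

∑S*s≡δ : ∀ n k → ∑[ i < suc n ] S n i * s i k ≡ δ n k
∑S*s≡δ zero    zero    = refl
∑S*s≡δ zero    (suc k) = refl
∑S*s≡δ (suc n) zero    =
  cong₂ _+_ (ℚP.*-zeroˡ (s 0 0)) (∑-≡0 (suc n) (λ i _ → ℚP.*-zeroʳ (S (suc n) (suc i))))
∑S*s≡δ (suc n) (suc k) = begin
  S (suc n) 0 * s 0 (suc k) + ∑[ i < suc n ] S (suc n) (suc i) * s (suc i) (suc k)
    ≡⟨ cong₂ _+_ (ℚP.*-zeroˡ (s 0 (suc k))) (∑-cong (suc n) (λ i _ → telescopic i)) ⟩
  0ℚ + ∑[ i < suc n ] (S n i * s i k + (g (suc i) - g i))
    ≡⟨ ℚP.+-identityˡ _ ⟩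
  ∑[ i < suc n ] (S n i * s i k + (g (suc i) - g i))
    ≡⟨ ∑-distrib-+ (suc n) (λ i → S n i * s i k) (λ i → g (suc i) - g i) ⟩
  ∑[ i < suc n ] S n i * s i k + ∑[ i < suc n ] (g (suc i) - g i)
    ≡⟨ cong₂ _+_ (∑S*s≡δ n k) (∑-telescope (suc n) g) ⟩
  δ n k + (g (suc n) - g 0)
    ≡⟨ cong₂ (λ a b → δ n k + (a - b)) g[1+n]≡0 g[0]≡0 ⟩
  δ n k + 0ℚ
    ≡⟨ ℚP.+-identityʳ (δ n k) ⟩
  δ n k
    ∎
  where
  open ≡-Reasoning
  g : ℕ → ℚ
  g i = fromℕ i * S n i * s i (suc k)
  g[0]≡0 : g 0 ≡ 0ℚ
  g[0]≡0 = trans (cong (_* s 0 (suc k)) (ℚP.*-zeroˡ (S n 0))) (ℚP.*-zeroˡ (s 0 (suc k)))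
  g[1+n]≡0 : g (suc n) ≡ 0ℚ
  g[1+n]≡0 = begin
    fromℕ (suc n) * S n (suc n) * s (suc n) (suc k) ≡⟨ cong (λ x → fromℕ (suc n) * x * s (suc n) (suc k)) (S-vanish (ℕP.n<1+n n)) ⟩
    fromℕ (suc n) * 0ℚ * s (suc n) (suc k)          ≡⟨ cong (_* s (suc n) (suc k)) (ℚP.*-zeroʳ (fromℕ (suc n))) ⟩
    0ℚ * s (suc n) (suc k)                          ≡⟨ ℚP.*-zeroˡ (s (suc n) (suc k)) ⟩
    0ℚ                                              ∎
  telescopic : ∀ i → S (suc n) (suc i) * s (suc i) (suc k) ≡ S n i * s i k + (g (suc i) - g i)
  telescopic i = begin
    S (suc n) (suc i) * s (suc i) (suc k)
      ≡⟨ cong (_* s (suc i) (suc k)) (S-suc-suc n i) ⟩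
    (S n i + fromℕ (suc i) * S n (suc i)) * s (suc i) (suc k)
      ≡⟨ ℚP.*-distribʳ-+ (s (suc i) (suc k)) (S n i) _ ⟩
    S n i * s (suc i) (suc k) + g (suc i)
      ≡⟨ cong (λ x → S n i * x + g (suc i)) (s-suc-suc i k) ⟩
    S n i * (s i k - fromℕ i * s i (suc k)) + g (suc i)
      ≡⟨ solve 5 (λ a x m y z → a :* (x :- m :* y) :+ z := a :* x :+ (z :- m :* a :* y)) refl
           (S n i) (s i k) (fromℕ i) (s i (suc k)) (g (suc i)) ⟩
    S n i * s i k + (g (suc i) - g i)
      ∎

-- For f of degree below N (f k = 0 when N ≤ k) these are the coefficients of f (X + 1).
binomialTransform : ℕ → (ℕ → ℚ) → ℕ → ℚ
binomialTransform N f j = ∑[ k < N ] fromℕ (k C j) * f k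

binomialTransform-truncate : ∀ {M N} (f : ℕ → ℚ) j → M ≤ N → (∀ k → M ≤ k → f k ≡ 0ℚ) →
                             binomialTransform N f j ≡ binomialTransform M f j
binomialTransform-truncate f j M≤N f≡0 =
  ∑-truncate (λ k → fromℕ (k C j) * f k) M≤N
    (λ k M≤k → trans (cong (fromℕ (k C j) *_) (f≡0 k M≤k)) (ℚP.*-zeroʳ (fromℕ (k C j))))

binomialTransform-distrib-- : ∀ N (f g : ℕ → ℚ) j →
  binomialTransform N (λ k → f k - g k) j ≡ binomialTransform N f j - binomialTransform N g j
binomialTransform-distrib-- N f g j = trans
  (∑-cong N (λ k _ → solve 3 (λ c x y → c :* (x :- y) := c :* x :- c :* y) refl (fromℕ (k C j)) (f k) (g k)))
  (∑-distrib-- N (λ k → fromℕ (k C j) * f k) (λ k → fromℕ (k C j) * g k))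

fromℕ-pascal : ∀ k j → fromℕ (suc k C j) ≡ fromℕ (k C j) + shift (λ i → fromℕ (k C i)) j
fromℕ-pascal k zero    = sym (ℚP.+-identityʳ 1ℚ)
fromℕ-pascal k (suc j) = begin
  fromℕ (suc k C suc j)               ≡⟨ cong fromℕ (sym (nCk+nC[k+1]≡[n+1]C[k+1] k j)) ⟩
  fromℕ (k C j ℕ.+ k C suc j)         ≡⟨ fromℕ-+ (k C j) (k C suc j) ⟩
  fromℕ (k C j) + fromℕ (k C suc j)   ≡⟨ ℚP.+-comm (fromℕ (k C j)) (fromℕ (k C suc j)) ⟩
  fromℕ (k C suc j) + fromℕ (k C j)   ∎
  where open ≡-Reasoning

-- (X · f)(X + 1) = (X + 1) · f(X + 1)
binomialTransform-shift : ∀ N f j →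
  binomialTransform (suc N) (shift f) j ≡ binomialTransform N f j + shift (binomialTransform N f) j
binomialTransform-shift N f j = begin
  fromℕ (0 C j) * 0ℚ + ∑[ k < N ] fromℕ (suc k C j) * f k
    ≡⟨ cong (_+ ∑[ k < N ] fromℕ (suc k C j) * f k) (ℚP.*-zeroʳ (fromℕ (0 C j))) ⟩
  0ℚ + ∑[ k < N ] fromℕ (suc k C j) * f k
    ≡⟨ ℚP.+-identityˡ _ ⟩
  ∑[ k < N ] fromℕ (suc k C j) * f k
    ≡⟨ ∑-cong N (λ k _ → trans (cong (_* f k) (fromℕ-pascal k j)) (ℚP.*-distribʳ-+ (f k) (fromℕ (k C j)) (shift (λ i → fromℕ (k C i)) j))) ⟩
  ∑[ k < N ] (fromℕ (k C j) * f k + shift (λ i → fromℕ (k C i)) j * f k)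
    ≡⟨ ∑-distrib-+ N _ _ ⟩
  binomialTransform N f j + ∑[ k < N ] shift (λ i → fromℕ (k C i)) j * f k
    ≡⟨ cong (_+_ (binomialTransform N f j)) (∑-shift j) ⟩
  binomialTransform N f j + shift (binomialTransform N f) j
    ∎
  where
  open ≡-Reasoning
  ∑-shift : ∀ j → ∑[ k < N ] shift (λ i → fromℕ (k C i)) j * f k ≡ shift (binomialTransform N f) j
  ∑-shift zero    = ∑-≡0 N (λ k _ → ℚP.*-zeroˡ (f k))
  ∑-shift (suc j) = refl

binomialTransform-adjacent : ∀ {N j} (f : ℕ → ℚ) → suc j < N → (∀ k → suc j < k → f k ≡ 0ℚ) →
  binomialTransform N f j ≡ f j + fromℕ (suc j) * f (suc j)
binomialTransform-adjacent {N} {j} f 2+j≤N f≡0 = begin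
  binomialTransform N f j
    ≡⟨ binomialTransform-truncate f j 2+j≤N f≡0 ⟩
  ∑[ k < suc (suc j) ] F k
    ≡⟨ ∑-init-last (suc j) F ⟩
  ∑[ k < suc j ] F k + F (suc j)
    ≡⟨ cong (_+ F (suc j)) (∑-init-last j F) ⟩
  (∑[ k < j ] F k + F j) + F (suc j)
    ≡⟨ cong₂ (λ x c → (x + F j) + fromℕ c * f (suc j))
         (∑-≡0 j (λ k k<j → trans (cong (λ c → fromℕ c * f k) (k>n⇒nCk≡0 k<j)) (ℚP.*-zeroˡ (f k))))
         ([1+n]Cn≡1+n j) ⟩
  (0ℚ + fromℕ (j C j) * f j) + fromℕ (suc j) * f (suc j)
    ≡⟨ cong (λ c → (0ℚ + fromℕ c * f j) + fromℕ (suc j) * f (suc j)) (nCn≡1 j) ⟩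
  (0ℚ + 1ℚ * f j) + fromℕ (suc j) * f (suc j)
    ≡⟨ cong (_+ fromℕ (suc j) * f (suc j)) (trans (ℚP.+-identityˡ (1ℚ * f j)) (ℚP.*-identityˡ (f j))) ⟩
  f j + fromℕ (suc j) * f (suc j)
    ∎
  where
  open ≡-Reasoning
  F : ℕ → ℚ
  F k = fromℕ (k C j) * f k

binomialTransform-fixed⇒next≡0 : ∀ {n k} (f : ℕ → ℚ) → k < n → (∀ m → suc k < m → f m ≡ 0ℚ) →
  binomialTransform (suc n) f k ≡ f k → f (suc k) ≡ 0ℚ
binomialTransform-fixed⇒next≡0 {n} {k} f k<n vanish fixed = [1+n]*x≡0⇒x≡0 k
  (identityʳ-unique (f k) (fromℕ (suc k) * f (suc k))
    (trans (sym (binomialTransform-adjacent {suc n} {k} f (s≤s k<n) vanish)) fixed))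

-- f(X + 1) = f(X) forces a polynomial f to be constant.
binomialTransform-fixed⇒constant : ∀ {n} (f : ℕ → ℚ) → (∀ k → n < k → f k ≡ 0ℚ) →
  (∀ j → j < n → binomialTransform (suc n) f j ≡ f j) → ∀ k → f (suc k) ≡ 0ℚ
binomialTransform-fixed⇒constant {n} f f≡0 fixed = <-downward-induction (λ k → f (suc k) ≡ 0ℚ) n
  (λ k n≤k → f≡0 (suc k) (s≤s n≤k))
  (λ k k<n above → binomialTransform-fixed⇒next≡0 f k<n (vanish-above above) (fixed k k<n))
  where
  vanish-above : ∀ {k} → (∀ m → k < m → f (suc m) ≡ 0ℚ) → ∀ m → suc k < m → f m ≡ 0ℚ
  vanish-above above (suc m) (s≤s k<m) = above m k<m

binomialTransform-s-suc : ∀ N n j →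
  binomialTransform N (s (suc n)) j ≡ binomialTransform N (shift (s n)) j - fromℕ n * binomialTransform N (s n) j
binomialTransform-s-suc N n j = begin
  ∑[ k < N ] fromℕ (k C j) * s (suc n) k
    ≡⟨ ∑-cong N (λ k _ → trans (cong (fromℕ (k C j) *_) (s-suc n k))
         (solve 4 (λ c a m b → c :* (a :- m :* b) := c :* a :- m :* (c :* b)) refl (fromℕ (k C j)) (shift (s n) k) (fromℕ n) (s n k))) ⟩
  ∑[ k < N ] (fromℕ (k C j) * shift (s n) k - fromℕ n * (fromℕ (k C j) * s n k))
    ≡⟨ ∑-distrib-- N _ _ ⟩
  binomialTransform N (shift (s n)) j - ∑[ k < N ] fromℕ n * (fromℕ (k C j) * s n k)
    ≡⟨ cong (_-_ (binomialTransform N (shift (s n)) j)) (∑-*ˡ N (fromℕ n) _) ⟩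
  binomialTransform N (shift (s n)) j - fromℕ n * binomialTransform N (s n) j
    ∎
  where open ≡-Reasoning

-- (X + 1)^(n+1 falling) = (X + 1) · X^(n falling)
binomialTransform-s : ∀ n j → binomialTransform (suc (suc n)) (s (suc n)) j ≡ shift (s n) j + s n j
binomialTransform-s zero zero          = refl
binomialTransform-s zero (suc zero)    = refl
binomialTransform-s zero (suc (suc j)) = refl
binomialTransform-s (suc n) j = begin
  T (3 ℕ.+ n) (s (2 ℕ.+ n)) j
    ≡⟨ binomialTransform-s-suc (3 ℕ.+ n) (suc n) j ⟩
  T (3 ℕ.+ n) (shift (s (1 ℕ.+ n))) j - m * T (3 ℕ.+ n) (s (1 ℕ.+ n)) j
    ≡⟨ cong₂ (λ a b → a - m * b) (binomialTransform-shift (2 ℕ.+ n) (s (1 ℕ.+ n)) j)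
         (binomialTransform-truncate {2 ℕ.+ n} {3 ℕ.+ n} (s (1 ℕ.+ n)) j (ℕP.n≤1+n _) (λ k → s-vanish)) ⟩
  (T (2 ℕ.+ n) (s (1 ℕ.+ n)) j + shift (T (2 ℕ.+ n) (s (1 ℕ.+ n))) j) - m * T (2 ℕ.+ n) (s (1 ℕ.+ n)) j
    ≡⟨ cong₂ (λ a b → (a + b) - m * a) (binomialTransform-s n j) (shift-IH j) ⟩
  (P j + shift P j) - m * P j
    ≡⟨ commute j ⟩
  shift (s (suc n)) j + s (suc n) j
    ∎
  where
  open ≡-Reasoning
  T = binomialTransform
  m = fromℕ (suc n)
  P : ℕ → ℚ
  P j = shift (s n) j + s n j
  shift-IH : ∀ j → shift (T (2 ℕ.+ n) (s (1 ℕ.+ n))) j ≡ shift P j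
  shift-IH zero    = refl
  shift-IH (suc j) = binomialTransform-s n j
  -- coefficientwise (X − n) · (X + 1) · s n = (X + 1) · (X − n) · s n
  commute : ∀ j → (P j + shift P j) - m * P j ≡ shift (s (suc n)) j + s (suc n) j
  commute zero    = begin
    ((0ℚ + s n 0) + 0ℚ) - fromℕ (suc n) * (0ℚ + s n 0) ≡⟨ cong (λ x → ((0ℚ + s n 0) + 0ℚ) - x * (0ℚ + s n 0)) (fromℕ-suc n) ⟩
    ((0ℚ + s n 0) + 0ℚ) - (1ℚ + fromℕ n) * (0ℚ + s n 0) ≡⟨ solve 2 (λ x k → ((con 0ℚ :+ x) :+ con 0ℚ) :- (con 1ℚ :+ k) :* (con 0ℚ :+ x)
                                                                := con 0ℚ :+ (con 0ℚ :- k :* x)) refl (s n 0) (fromℕ n) ⟩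
    0ℚ + (0ℚ - fromℕ n * s n 0)                        ≡⟨ cong (_+_ 0ℚ) (sym (s-suc n 0)) ⟩
    0ℚ + s (suc n) 0                                  ∎
  commute (suc j) = begin
    ((a + b) + (c + a)) - fromℕ (suc n) * (a + b)     ≡⟨ cong (λ x → ((a + b) + (c + a)) - x * (a + b)) (fromℕ-suc n) ⟩
    ((a + b) + (c + a)) - (1ℚ + fromℕ n) * (a + b)    ≡⟨ solve 4 (λ a b c k → ((a :+ b) :+ (c :+ a)) :- (con 1ℚ :+ k) :* (a :+ b)
                                                                := (c :- k :* a) :+ (a :- k :* b)) refl a b c (fromℕ n) ⟩
    (c - fromℕ n * a) + (a - fromℕ n * b)              ≡⟨ sym (cong₂ _+_ (s-suc n j) (s-suc-suc n j)) ⟩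
    s (suc n) j + s (suc n) (suc j)                   ∎
    where
    a = s n j
    b = s n (suc j)
    c = shift (s n) j

-- The left-hand side of the theorem for n = p + 1, with i shifted down by one.
stirlingSum : ℕ → ℕ → ℚ
stirlingSum p k = ∑[ i < suc p ] S p i * s (suc i) k * recipℕ (suc i)

binomialTransform-stirlingSum : ∀ p j → binomialTransform (suc (suc p)) (stirlingSum p) j ≡ stirlingSum p j + δ p j
binomialTransform-stirlingSum p j = begin
  ∑[ k < N ] fromℕ (k C j) * (∑[ i < suc p ] S p i * s (suc i) k * recipℕ (suc i))
    ≡⟨ ∑-cong N (λ k _ → sym (∑-*ˡ (suc p) (fromℕ (k C j)) (λ i → S p i * s (suc i) k * recipℕ (suc i)))) ⟩
  ∑[ k < N ] ∑[ i < suc p ] fromℕ (k C j) * (S p i * s (suc i) k * recipℕ (suc i))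
    ≡⟨ ∑-comm N (suc p) (λ k i → fromℕ (k C j) * (S p i * s (suc i) k * recipℕ (suc i))) ⟩
  ∑[ i < suc p ] ∑[ k < N ] fromℕ (k C j) * (S p i * s (suc i) k * recipℕ (suc i))
    ≡⟨ ∑-cong (suc p) (λ i _ → trans (∑-cong N (λ k _ → regroup i k)) (∑-*ˡ N (a i) (λ k → fromℕ (k C j) * s (suc i) k))) ⟩
  ∑[ i < suc p ] a i * binomialTransform N (s (suc i)) j
    ≡⟨ ∑-cong (suc p) (λ i i≤p → cong (a i *_) (trans
         (binomialTransform-truncate (s (suc i)) j (s≤s i≤p) (λ k → s-vanish))
         (binomialTransform-s i j))) ⟩
  ∑[ i < suc p ] a i * (shift (s i) j + s i j)
    ≡⟨ ∑-cong (suc p) (λ i _ → split i) ⟩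
  ∑[ i < suc p ] (S p i * s (suc i) j * recipℕ (suc i) + S p i * s i j)
    ≡⟨ ∑-distrib-+ (suc p) (λ i → S p i * s (suc i) j * recipℕ (suc i)) (λ i → S p i * s i j) ⟩
  stirlingSum p j + ∑[ i < suc p ] S p i * s i j
    ≡⟨ cong (_+_ (stirlingSum p j)) (∑S*s≡δ p j) ⟩
  stirlingSum p j + δ p j
    ∎
  where
  open ≡-Reasoning
  N = suc (suc p)
  a : ℕ → ℚ
  a i = S p i * recipℕ (suc i)
  regroup : ∀ i k → fromℕ (k C j) * (S p i * s (suc i) k * recipℕ (suc i)) ≡ a i * (fromℕ (k C j) * s (suc i) k)
  regroup i k = solve 4 (λ c x y r → c :* (x :* y :* r) := (x :* r) :* (c :* y)) refl
    (fromℕ (k C j)) (S p i) (s (suc i) k) (recipℕ (suc i))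
  split : ∀ i → a i * (shift (s i) j + s i j) ≡ S p i * s (suc i) j * recipℕ (suc i) + S p i * s i j
  split i = begin
    a i * (shift (s i) j + s i j)
      ≡⟨ cong (λ y → a i * (y + s i j)) (shift-s i j) ⟩
    S p i * recipℕ (suc i) * ((s (suc i) j + fromℕ i * s i j) + s i j)
      ≡⟨ solve 5 (λ x r y m z → x :* r :* ((y :+ m :* z) :+ z) := x :* y :* r :+ x :* (((con 1ℚ :+ m) :* r) :* z)) refl
           (S p i) (recipℕ (suc i)) (s (suc i) j) (fromℕ i) (s i j) ⟩
    S p i * s (suc i) j * recipℕ (suc i) + S p i * (((1ℚ + fromℕ i) * recipℕ (suc i)) * s i j)
      ≡⟨ cong (λ m → S p i * s (suc i) j * recipℕ (suc i) + S p i * ((m * recipℕ (suc i)) * s i j))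
           (sym (fromℕ-suc i)) ⟩
    S p i * s (suc i) j * recipℕ (suc i) + S p i * ((fromℕ (suc i) * recipℕ (suc i)) * s i j)
      ≡⟨ cong (λ m → S p i * s (suc i) j * recipℕ (suc i) + S p i * (m * s i j)) (fromℕ-*-recipℕ i) ⟩
    S p i * s (suc i) j * recipℕ (suc i) + S p i * (1ℚ * s i j)
      ≡⟨ cong (λ y → S p i * s (suc i) j * recipℕ (suc i) + S p i * y) (ℚP.*-identityˡ (s i j)) ⟩
    S p i * s (suc i) j * recipℕ (suc i) + S p i * s i j
      ∎

-- `bernoulliList` reads earlier values through helpers private to Defs. Unification recovers
-- them as `lookupᴮ` and `lengthᴮ`; abstracting over `_∸_` turns the problem into a pattern.
mutual
  lookupᴮ : (ℕ → ℕ → ℕ) → List ℚ → ℕ → ℚ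
  lookupᴮ = _

  lengthᴮ : List ℚ → ℕ
  lengthᴮ = _

  indexᴮ : List ℚ → ℕ → ℚ
  indexᴮ = lookupᴮ (λ _ → ℕ.pred)

  bernoulli-suc-unfold : ∀ m → bernoulli (suc m) ≡
    - (recipℕ (suc (suc m)) * sumℚ (map (λ j → fromℕ (suc (suc m) C j) * lookupᴮ _∸_ (bernoulliList m) j) (upTo (suc m))))
  bernoulli-suc-unfold m with bernoulliList m | ℚ._+_ | ℚ._*_ | ℕ._∸_
  ... | _ | _ | _ | _ = refl

  lookupᴮ≡indexᴮ : ∀ minus xs j → lookupᴮ minus xs j ≡ indexᴮ xs (minus (lengthᴮ xs) (suc j))
  lookupᴮ≡indexᴮ _ _ _ = refl

lengthᴮ-bernoulliList : ∀ m → lengthᴮ (bernoulliList m) ≡ suc m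
lengthᴮ-bernoulliList zero    = refl
lengthᴮ-bernoulliList (suc m) = cong suc (lengthᴮ-bernoulliList m)

indexᴮ-bernoulliList : ∀ j d → indexᴮ (bernoulliList (d ℕ.+ j)) d ≡ bernoulli j
indexᴮ-bernoulliList zero    zero    = refl
indexᴮ-bernoulliList (suc j) zero    = refl
indexᴮ-bernoulliList j       (suc d) = indexᴮ-bernoulliList j d

bernoulli-suc : ∀ m → bernoulli (suc m) ≡ - (recipℕ (suc (suc m)) * (∑[ j < suc m ] fromℕ (suc (suc m) C j) * bernoulli j))
bernoulli-suc m = trans (bernoulli-suc-unfold m) (cong (λ x → - (recipℕ (suc (suc m)) * x))
  (trans (sumℚ-map-applyUpTo (λ j → fromℕ (suc (suc m) C j) * lookupᴮ _∸_ (bernoulliList m) j) (λ j → j) (suc m))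
         (∑-cong (suc m) (λ j j<1+m → cong (fromℕ (suc (suc m) C j) *_) (lookupᴮ-bernoulliList j<1+m)))))
  where
  open ≡-Reasoning
  lookupᴮ-bernoulliList : ∀ {j} → j < suc m → lookupᴮ _∸_ (bernoulliList m) j ≡ bernoulli j
  lookupᴮ-bernoulliList {j} (s≤s j≤m) = begin
    lookupᴮ _∸_ (bernoulliList m) j                               ≡⟨ lookupᴮ≡indexᴮ _∸_ (bernoulliList m) j ⟩
    indexᴮ (bernoulliList m) (lengthᴮ (bernoulliList m) ∸ suc j)  ≡⟨ cong (λ l → indexᴮ (bernoulliList m) (l ∸ suc j)) (lengthᴮ-bernoulliList m) ⟩
    indexᴮ (bernoulliList m) (m ∸ j)                              ≡⟨ cong (λ l → indexᴮ (bernoulliList l) (m ∸ j)) (sym (ℕP.m∸n+n≡m j≤m)) ⟩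
    indexᴮ (bernoulliList (m ∸ j ℕ.+ j)) (m ∸ j)                  ≡⟨ indexᴮ-bernoulliList j (m ∸ j) ⟩
    bernoulli j                                                   ∎

∑-binomial-bernoulli : ∀ N → ∑[ i < N ] fromℕ (N C i) * bernoulli i ≡ δ N 1
∑-binomial-bernoulli zero          = refl
∑-binomial-bernoulli (suc zero)    = refl
∑-binomial-bernoulli (suc (suc m)) = begin
  ∑[ i < suc (suc m) ] fromℕ (suc (suc m) C i) * bernoulli i
    ≡⟨ ∑-init-last (suc m) (λ i → fromℕ (suc (suc m) C i) * bernoulli i) ⟩
  X + fromℕ (suc (suc m) C suc m) * bernoulli (suc m)
    ≡⟨ cong₂ (λ c b → X + fromℕ c * b) ([1+n]Cn≡1+n (suc m)) (bernoulli-suc m) ⟩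
  X + fromℕ (suc (suc m)) * - (recipℕ (suc (suc m)) * X)
    ≡⟨ solve 3 (λ x a b → x :+ a :* (:- (b :* x)) := x :- (a :* b) :* x) refl X (fromℕ (suc (suc m))) (recipℕ (suc (suc m))) ⟩
  X - fromℕ (suc (suc m)) * recipℕ (suc (suc m)) * X
    ≡⟨ cong (λ y → X - y * X) (fromℕ-*-recipℕ (suc m)) ⟩
  X - 1ℚ * X
    ≡⟨ cong (_-_ X) (ℚP.*-identityˡ X) ⟩
  X - X
    ≡⟨ ℚP.+-inverseʳ X ⟩
  0ℚ
    ∎
  where
  open ≡-Reasoning
  X = ∑[ i < suc m ] fromℕ (suc (suc m) C i) * bernoulli i

∑-binomial-bernoulli-reversed : ∀ N → ∑[ i < suc N ] fromℕ (N C i) * bernoulli (N ∸ i) ≡ bernoulli N + δ N 1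
∑-binomial-bernoulli-reversed N = begin
  ∑[ i < suc N ] fromℕ (N C i) * bernoulli (N ∸ i)
    ≡⟨ ∑-reverse (suc N) (λ i → fromℕ (N C i) * bernoulli (N ∸ i)) ⟩
  ∑[ i < suc N ] fromℕ (N C (N ∸ i)) * bernoulli (N ∸ (N ∸ i))
    ≡⟨ ∑-cong (suc N) (λ i i<1+N → cong₂ (λ c b → fromℕ c * bernoulli b)
         (sym (nCk≡nC[n∸k] (ℕP.≤-pred i<1+N))) (ℕP.m∸[m∸n]≡n (ℕP.≤-pred i<1+N))) ⟩
  ∑[ i < suc N ] fromℕ (N C i) * bernoulli i
    ≡⟨ ∑-init-last N (λ i → fromℕ (N C i) * bernoulli i) ⟩
  ∑[ i < N ] fromℕ (N C i) * bernoulli i + fromℕ (N C N) * bernoulli N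
    ≡⟨ cong₂ (λ x c → x + fromℕ c * bernoulli N) (∑-binomial-bernoulli N) (nCn≡1 N) ⟩
  δ N 1 + 1ℚ * bernoulli N
    ≡⟨ trans (cong (_+_ (δ N 1)) (ℚP.*-identityˡ (bernoulli N))) (ℚP.+-comm (δ N 1) (bernoulli N)) ⟩
  bernoulli N + δ N 1
    ∎
  where open ≡-Reasoning

bernoulliTerm : ℕ → ℕ → ℚ
bernoulliTerm p k = recipℕ (suc p) * fromℕ (suc p C k) * bernoulli (suc p ∸ k)

bernoulliTerm-revision : ∀ j r m → m ≤ suc r →
  fromℕ ((j ℕ.+ m) C j) * bernoulliTerm (j ℕ.+ r) (j ℕ.+ m)
    ≡ recipℕ (suc (j ℕ.+ r)) * fromℕ (suc (j ℕ.+ r) C j) * (fromℕ (suc r C m) * bernoulli (suc r ∸ m))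
bernoulliTerm-revision j r m m≤1+r = begin
  fromℕ ((j ℕ.+ m) C j) * (recipℕ n * fromℕ (n C (j ℕ.+ m)) * bernoulli (n ∸ (j ℕ.+ m)))
    ≡⟨ solve 4 (λ a q c b → a :* (q :* c :* b) := q :* (c :* a) :* b) refl
         (fromℕ ((j ℕ.+ m) C j)) (recipℕ n) (fromℕ (n C (j ℕ.+ m))) (bernoulli (n ∸ (j ℕ.+ m))) ⟩
  recipℕ n * (fromℕ (n C (j ℕ.+ m)) * fromℕ ((j ℕ.+ m) C j)) * bernoulli (n ∸ (j ℕ.+ m))
    ≡⟨ cong₂ (λ c l → recipℕ n * c * bernoulli l) binomials
         (trans (cong (_∸ (j ℕ.+ m)) (sym (ℕP.+-suc j r))) (ℕP.[m+n]∸[m+o]≡n∸o j (suc r) m)) ⟩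
  recipℕ n * (fromℕ (n C j) * fromℕ (suc r C m)) * bernoulli (suc r ∸ m)
    ≡⟨ solve 4 (λ q a b x → q :* (a :* b) :* x := (q :* a) :* (b :* x)) refl
         (recipℕ n) (fromℕ (n C j)) (fromℕ (suc r C m)) (bernoulli (suc r ∸ m)) ⟩
  recipℕ n * fromℕ (n C j) * (fromℕ (suc r C m) * bernoulli (suc r ∸ m))
    ∎
  where
  open ≡-Reasoning
  n = suc (j ℕ.+ r)
  n≡j+[m+t] : j ℕ.+ (m ℕ.+ (suc r ∸ m)) ≡ n
  n≡j+[m+t] = trans (cong (j ℕ.+_) (ℕP.m+[n∸m]≡n m≤1+r)) (ℕP.+-suc j r)
  binomials : fromℕ (n C (j ℕ.+ m)) * fromℕ ((j ℕ.+ m) C j) ≡ fromℕ (n C j) * fromℕ (suc r C m)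
  binomials = begin
    fromℕ (n C (j ℕ.+ m)) * fromℕ ((j ℕ.+ m) C j)   ≡⟨ sym (fromℕ-* (n C (j ℕ.+ m)) ((j ℕ.+ m) C j)) ⟩
    fromℕ ((n C (j ℕ.+ m)) ℕ.* ((j ℕ.+ m) C j))     ≡⟨ cong fromℕ (subst (λ l → (l C (j ℕ.+ m)) ℕ.* ((j ℕ.+ m) C j) ≡ (l C j) ℕ.* ((m ℕ.+ (suc r ∸ m)) C m))
                                                           n≡j+[m+t] (C-trinomial j m (suc r ∸ m))) ⟩
    fromℕ ((n C j) ℕ.* ((m ℕ.+ (suc r ∸ m)) C m))    ≡⟨ cong (λ l → fromℕ ((n C j) ℕ.* (l C m))) (ℕP.m+[n∸m]≡n m≤1+r) ⟩
    fromℕ ((n C j) ℕ.* (suc r C m))                 ≡⟨ fromℕ-* (n C j) (suc r C m) ⟩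
    fromℕ (n C j) * fromℕ (suc r C m)               ∎

recipℕ*C*δ≡δ : ∀ j o → recipℕ (suc (j ℕ.+ o)) * fromℕ (suc (j ℕ.+ o) C j) * δ o 0 ≡ δ o 0
recipℕ*C*δ≡δ j zero    = begin
  recipℕ (suc (j ℕ.+ 0)) * fromℕ (suc (j ℕ.+ 0) C j) * 1ℚ  ≡⟨ ℚP.*-identityʳ (recipℕ (suc (j ℕ.+ 0)) * fromℕ (suc (j ℕ.+ 0) C j)) ⟩
  recipℕ (suc (j ℕ.+ 0)) * fromℕ (suc (j ℕ.+ 0) C j)       ≡⟨ cong (λ l → recipℕ (suc l) * fromℕ (suc l C j)) (ℕP.+-identityʳ j) ⟩
  recipℕ (suc j) * fromℕ (suc j C j)                       ≡⟨ cong (λ c → recipℕ (suc j) * fromℕ c) ([1+n]Cn≡1+n j) ⟩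
  recipℕ (suc j) * fromℕ (suc j)                           ≡⟨ ℚP.*-comm (recipℕ (suc j)) (fromℕ (suc j)) ⟩
  fromℕ (suc j) * recipℕ (suc j)                           ≡⟨ fromℕ-*-recipℕ j ⟩
  1ℚ                                                       ∎
  where open ≡-Reasoning
recipℕ*C*δ≡δ j (suc o) = ℚP.*-zeroʳ (recipℕ (suc (j ℕ.+ suc o)) * fromℕ (suc (j ℕ.+ suc o) C j))

binomialTransform-bernoulliTerm[j+r] : ∀ j r →
  binomialTransform (suc (suc (j ℕ.+ r))) (bernoulliTerm (j ℕ.+ r)) j ≡ bernoulliTerm (j ℕ.+ r) j + δ (j ℕ.+ r) j
binomialTransform-bernoulliTerm[j+r] j r = begin
  ∑[ k < suc n ] F k
    ≡⟨ cong (λ l → ∑ l F) 2+p≡j+[2+r] ⟩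
  ∑[ k < j ℕ.+ suc (suc r) ] F k
    ≡⟨ ∑-split j (suc (suc r)) F ⟩
  ∑[ k < j ] F k + ∑[ m < suc (suc r) ] F (j ℕ.+ m)
    ≡⟨ cong₂ _+_ (∑-≡0 j (λ k k<j → trans (cong (λ c → fromℕ c * bernoulliTerm p k) (k>n⇒nCk≡0 k<j))
                                           (ℚP.*-zeroˡ (bernoulliTerm p k))))
                 (∑-cong (suc (suc r)) (λ m m≤1+r → bernoulliTerm-revision j r m (ℕP.≤-pred m≤1+r))) ⟩
  0ℚ + ∑[ m < suc (suc r) ] K * (fromℕ (suc r C m) * bernoulli (suc r ∸ m))
    ≡⟨ trans (ℚP.+-identityˡ _) (∑-*ˡ (suc (suc r)) K (λ m → fromℕ (suc r C m) * bernoulli (suc r ∸ m))) ⟩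
  K * (∑[ m < suc (suc r) ] fromℕ (suc r C m) * bernoulli (suc r ∸ m))
    ≡⟨ cong (K *_) (∑-binomial-bernoulli-reversed (suc r)) ⟩
  K * (bernoulli (suc r) + δ r 0)
    ≡⟨ ℚP.*-distribˡ-+ K (bernoulli (suc r)) (δ r 0) ⟩
  K * bernoulli (suc r) + K * δ r 0
    ≡⟨ cong₂ _+_ (cong (λ l → K * bernoulli l) (sym n∸j≡1+r)) (recipℕ*C*δ≡δ j r) ⟩
  bernoulliTerm p j + δ r 0
    ≡⟨ cong (_+_ (bernoulliTerm p j)) (sym (δ-+ˡ j r)) ⟩
  bernoulliTerm p j + δ p j
    ∎
  where
  open ≡-Reasoning
  p = j ℕ.+ r
  n = suc p
  F : ℕ → ℚ
  F k = fromℕ (k C j) * bernoulliTerm p k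
  K : ℚ
  K = recipℕ n * fromℕ (n C j)
  n≡j+[1+r] : n ≡ j ℕ.+ suc r
  n≡j+[1+r] = sym (ℕP.+-suc j r)
  2+p≡j+[2+r] : suc n ≡ j ℕ.+ suc (suc r)
  2+p≡j+[2+r] = trans (cong suc n≡j+[1+r]) (sym (ℕP.+-suc j (suc r)))
  n∸j≡1+r : n ∸ j ≡ suc r
  n∸j≡1+r = trans (cong (_∸ j) n≡j+[1+r]) (ℕP.m+n∸m≡n j (suc r))

binomialTransform-bernoulliTerm : ∀ {p j} → j ≤ p →
  binomialTransform (suc (suc p)) (bernoulliTerm p) j ≡ bernoulliTerm p j + δ p j
binomialTransform-bernoulliTerm {j = j} j≤p =
  let r , j+r≡p = ℕP.m≤n⇒∃[o]m+o≡n j≤p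
  in subst (λ p → binomialTransform (suc (suc p)) (bernoulliTerm p) j ≡ bernoulliTerm p j + δ p j)
           j+r≡p (binomialTransform-bernoulliTerm[j+r] j r)

stirlingSum-vanish : ∀ {p k} → suc p < k → stirlingSum p k ≡ 0ℚ
stirlingSum-vanish {p} {k} 1+p<k = ∑-≡0 (suc p) (λ i i≤p →
  trans (cong (λ x → S p i * x * recipℕ (suc i)) (s-vanish (ℕP.<-≤-trans (s≤s i≤p) 1+p<k)))
        (x*0*y≡0 (S p i) (recipℕ (suc i))))

bernoulliTerm-vanish : ∀ {p k} → suc p < k → bernoulliTerm p k ≡ 0ℚ
bernoulliTerm-vanish {p} {k} 1+p<k =
  trans (cong (λ c → recipℕ (suc p) * fromℕ c * bernoulli (suc p ∸ k)) (k>n⇒nCk≡0 1+p<k))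
        (x*0*y≡0 (recipℕ (suc p)) (bernoulli (suc p ∸ k)))

stirlingSum≡bernoulliTerm : ∀ p k → stirlingSum p (suc k) ≡ bernoulliTerm p (suc k)
stirlingSum≡bernoulliTerm p k = x∙y⁻¹≈ε⇒x≈y _ _ (binomialTransform-fixed⇒constant D D-vanish D-fixed k)
  where
  open ≡-Reasoning
  D : ℕ → ℚ
  D k = stirlingSum p k - bernoulliTerm p k
  D-vanish : ∀ k → suc p < k → D k ≡ 0ℚ
  D-vanish k 1+p<k = cong₂ _-_ (stirlingSum-vanish 1+p<k) (bernoulliTerm-vanish 1+p<k)
  D-fixed : ∀ j → j < suc p → binomialTransform (suc (suc p)) D j ≡ D j
  D-fixed j (s≤s j≤p) = begin
    binomialTransform (suc (suc p)) D j
      ≡⟨ binomialTransform-distrib-- (suc (suc p)) (stirlingSum p) (bernoulliTerm p) j ⟩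
    binomialTransform (suc (suc p)) (stirlingSum p) j - binomialTransform (suc (suc p)) (bernoulliTerm p) j
      ≡⟨ cong₂ _-_ (binomialTransform-stirlingSum p j) (binomialTransform-bernoulliTerm j≤p) ⟩
    (stirlingSum p j + δ p j) - (bernoulliTerm p j + δ p j)
      ≡⟨ solve 3 (λ x y d → (x :+ d) :- (y :+ d) := x :- y) refl (stirlingSum p j) (bernoulliTerm p j) (δ p j) ⟩
    D j
      ∎

term-suc : ∀ p k i → term (suc p) k (suc i) ≡ S p i * s (suc i) k * recipℕ (suc i)
term-suc p k i = trans (/-suc≡*recipℕ (+ stirling2 p i ℤ.* stirling1 (suc i) k) i)
  (cong (_* recipℕ (suc i)) (fromℤ-* (+ stirling2 p i) (stirling1 (suc i) k)))

sumℚ-term≡stirlingSum : ∀ p k → k ≤ suc p → sumℚ (map (term (suc p) k) (rangeFromTo k (suc p))) ≡ stirlingSum p k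
sumℚ-term≡stirlingSum p k k≤1+p = begin
  sumℚ (map (term (suc p) k) (map (k ℕ.+_) (upTo (suc (suc p) ∸ k))))
    ≡⟨ cong sumℚ (sym (map-∘ (upTo (suc (suc p) ∸ k)))) ⟩
  sumℚ (map (t ∘ (k ℕ.+_)) (upTo (suc (suc p) ∸ k)))
    ≡⟨ sumℚ-map-applyUpTo (t ∘ (k ℕ.+_)) (λ i → i) (suc (suc p) ∸ k) ⟩
  ∑[ i < suc (suc p) ∸ k ] t (k ℕ.+ i)
    ≡⟨ sym (ℚP.+-identityˡ _) ⟩
  0ℚ + ∑[ i < suc (suc p) ∸ k ] t (k ℕ.+ i)
    ≡⟨ cong (_+ ∑[ i < suc (suc p) ∸ k ] t (k ℕ.+ i)) (sym (∑-≡0 k below-k)) ⟩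
  ∑ k t + ∑[ i < suc (suc p) ∸ k ] t (k ℕ.+ i)
    ≡⟨ sym (∑-split k (suc (suc p) ∸ k) t) ⟩
  ∑ (k ℕ.+ (suc (suc p) ∸ k)) t
    ≡⟨ cong (λ l → ∑ l t) (ℕP.m+[n∸m]≡n (ℕP.m≤n⇒m≤1+n k≤1+p)) ⟩
  t 0 + ∑[ i < suc p ] t (suc i)
    ≡⟨ ℚP.+-identityˡ _ ⟩
  ∑[ i < suc p ] t (suc i)
    ≡⟨ ∑-cong (suc p) (λ i _ → term-suc p k i) ⟩
  stirlingSum p k
    ∎
  where
  open ≡-Reasoning
  t = term (suc p) k
  below-k : ∀ i → i < k → t i ≡ 0ℚ
  below-k zero    _   = refl
  below-k (suc i) i<k = trans (term-suc p k i) (trans (cong (λ x → S p i * x * recipℕ (suc i)) (s-vanish i<k))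
    (x*0*y≡0 (S p i) (recipℕ (suc i))))

corollary2 : (n k : ℕ) → 1 ≤ k → k ≤ n →
    sumℚ (map (term n k) (rangeFromTo k n))
      ≡ (recipℕ n * ((+ (n C k)) / 1)) * bernoulli (n ∸ k)
corollary2 (suc p) (suc k) _ k≤n = trans (sumℚ-term≡stirlingSum p (suc k) k≤n) (stirlingSum≡bernoulliTerm p k)
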